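{- Let $k$ be a positive integer and let $G$ be a pseudo $k$-regular graph of order $n$ having a vertex $i$ of degree $d_i\geq k^2-3k+5$. Then (i) every neighbor $j$ of $i$ has degree $d_j=k$, and (ii) $n\geq f(k):=\left\lceil \dfrac{5k^4-31k^3+94k^2-140k+100}{k^2}\right\rceil$.
   Context: All graphs are finite, simple and without isolated vertices. For a vertex $i$, $d_i$ is its degree and $m_i=d_i^{ -1}\sum_{j:\, ji\in E(G)} d_j$ is its average $2$-degree. A graph is $k$-harmonic if $m_i=k$ for all vertices $i$; it is pseudo $k$-regular if it is $k$-harmonic but not $k$-regular. -}

module Defs where

open import Data.Bool using (Bool; true; false; if_then_else_)
open import Data.Nat using (ℕ; zero; suc; _+_; _*_; _≤_)
open import Data.Fin using (Fin)
open import Data.List using (List; map; allFin)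
open import Data.Nat.ListAction using (sum)
open import Data.Integer as ℤ using (ℤ; +_; -_)
open import Data.Integer.DivMod using (_/ℕ_)
open import Data.Product using (_×_; Σ)
open import Relation.Binary.PropositionalEquality using (_≡_; _≢_)
open import Relation.Nullary using (¬_)

record Graph (n : ℕ) : Set where
  field
    adj     : Fin n → Fin n → Bool
    sym     : ∀ i j → adj i j ≡ adj j i
    irrefl  : ∀ i → adj i i ≡ false

open Graph public

Σv : ∀ {n} → (Fin n → ℕ) → ℕ
Σv {n} f = sum (map f (allFin n))

deg : ∀ {n} → Graph n → Fin n → ℕ
deg G i = Σv (λ j → if adj G i j then 1 else 0)

-- sum of the degrees of the neighbours of i, i.e. d_i * m_i
twoDegSum : ∀ {n} → Graph n → Fin n → ℕ
twoDegSum G i = Σv (λ j → if adj G i j then deg G j else 0)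

NoIsolated : ∀ {n} → Graph n → Set
NoIsolated G = ∀ i → 1 ≤ deg G i

-- k-harmonic: m_i = k for all i, i.e. (since d_i > 0) Σ_{j ~ i} d_j = k * d_i
Harmonic : ∀ {n} → ℕ → Graph n → Set
Harmonic k G = ∀ i → twoDegSum G i ≡ k * deg G i

Regular : ∀ {n} → ℕ → Graph n → Set
Regular k G = ∀ i → deg G i ≡ k

PseudoRegular : ∀ {n} → ℕ → Graph n → Set
PseudoRegular k G = Harmonic k G × ¬ Regular k G

-- ceiling of a / (suc d) for integer a
ceilDiv : ℤ → ℕ → ℤ
ceilDiv a d = - ((- a) /ℕ suc d)

numer : ℕ → ℤ
numer k = let z = + k in
  + 5 ℤ.* z ℤ.* z ℤ.* z ℤ.* z ℤ.- + 31 ℤ.* z ℤ.* z ℤ.* z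
    ℤ.+ + 94 ℤ.* z ℤ.* z ℤ.- + 140 ℤ.* z ℤ.+ + 100

-- f(k) = ⌈ numer k / k^2 ⌉ for k ≥ 1 (value at k = 0 is irrelevant)
f : ℕ → ℤ
f zero = + 0
f (suc k) = ceilDiv (numer (suc k)) (k * suc k + k)

module Submission where

-- Write Σ_{j~i} w_j for sums over neighbours; k-harmonicity says Σ_{j~i} d_j = k d_i.
-- (i) A neighbour j of i with d_j < k has no leaf neighbour (a leaf l next to j would
--     give d_j = d_l m_l = k), so k d_j = Σ_{m~j} d_m ≥ 2 d_j + (d − 2), which the degree
--     threshold makes impossible.  Hence all neighbours have degree ≥ k, and since their
--     degrees sum to k d, all equal k.
-- (ii) Double counting gives Σ_v d_v² = Σ_v k d_v, so the deficits d_v(k ∸ d_v) and the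
--     excesses d_v(d_v ∸ k) have equal totals.  Each neighbour of i contributes k² and
--     every other vertex v contributes 4 d_v(k ∸ d_v) ≤ k² (AM–GM), i itself contributing
--     0; comparing with 4·excess(i) yields k² + k² d + 4 d(d − k) ≤ k² n.  At the
--     threshold d₀ = k² − 3k + 5 the left side is the numerator of f(k).

open import Defs hiding (sym)
open import Data.Bool using (Bool; true; false; if_then_else_)
open import Data.Nat
open import Data.Nat.Properties
open import Data.Nat.ListAction using (sum)
open import Data.Nat.Tactic.RingSolver using (solve-∀)
open import Data.Fin using (Fin)
open import Data.List using (List; []; _∷_; map; length; allFin)
open import Data.List.Properties using (length-tabulate)
open import Data.List.Membership.Propositional using (_∈_)
open import Data.List.Membership.Propositional.Properties using (∈-allFin)
open import Data.List.Relation.Unary.Any using (here; there)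
open import Data.Integer as ℤ using (ℤ; -_)
import Data.Integer.Properties as ℤP
import Data.Integer.DivMod as ℤDiv
import Data.Integer.Tactic.RingSolver as ℤSolver
open import Data.Product using (_×_; _,_; ∃)
open import Data.Sum using (inj₁; inj₂)
open import Data.Empty using (⊥; ⊥-elim)
open import Relation.Binary.PropositionalEquality

module ListSums {A : Set} where

  sumOf : (A → ℕ) → List A → ℕ
  sumOf f xs = sum (map f xs)

  sumOf-cong : ∀ {f g : A → ℕ} → (∀ x → f x ≡ g x) → ∀ xs → sumOf f xs ≡ sumOf g xs
  sumOf-cong f≡g []       = refl
  sumOf-cong f≡g (x ∷ xs) = cong₂ _+_ (f≡g x) (sumOf-cong f≡g xs)

  sumOf-+ : ∀ (f g : A → ℕ) xs → sumOf (λ x → f x + g x) xs ≡ sumOf f xs + sumOf g xs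
  sumOf-+ f g []       = refl
  sumOf-+ f g (x ∷ xs) rewrite sumOf-+ f g xs = interchange (f x) (g x) (sumOf f xs) (sumOf g xs)
    where
    interchange : ∀ a b c d → a + b + (c + d) ≡ a + c + (b + d)
    interchange = solve-∀

  sumOf-* : ∀ c (f : A → ℕ) xs → sumOf (λ x → c * f x) xs ≡ c * sumOf f xs
  sumOf-* c f []       = sym (*-zeroʳ c)
  sumOf-* c f (x ∷ xs) rewrite sumOf-* c f xs = sym (*-distribˡ-+ c (f x) (sumOf f xs))

  sumOf-const : ∀ c (xs : List A) → sumOf (λ _ → c) xs ≡ c * length xs
  sumOf-const c []       = sym (*-zeroʳ c)
  sumOf-const c (x ∷ xs) rewrite sumOf-const c xs = sym (*-suc c (length xs))

  sumOf-mono : ∀ {f g : A → ℕ} → (∀ x → f x ≤ g x) → ∀ xs → sumOf f xs ≤ sumOf g xs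
  sumOf-mono f≤g []       = z≤n
  sumOf-mono f≤g (x ∷ xs) = +-mono-≤ (f≤g x) (sumOf-mono f≤g xs)

  sumOf-slack : ∀ {f g : A → ℕ} {s x xs} → (∀ y → f y ≤ g y) → x ∈ xs →
                s + f x ≤ g x → s + sumOf f xs ≤ sumOf g xs
  sumOf-slack {f} {g} {s} {xs = y ∷ ys} f≤g (here refl) gap = begin
      s + (f y + sumOf f ys) ≡⟨ +-assoc s (f y) _ ⟨
      s + f y + sumOf f ys   ≤⟨ +-mono-≤ gap (sumOf-mono f≤g ys) ⟩
      g y + sumOf g ys       ∎
    where open ≤-Reasoning
  sumOf-slack {f} {g} {s} {xs = y ∷ ys} f≤g (there x∈ys) gap = begin
      s + (f y + sumOf f ys) ≡⟨ swapFront s (f y) (sumOf f ys) ⟩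
      f y + (s + sumOf f ys) ≤⟨ +-mono-≤ (f≤g y) (sumOf-slack f≤g x∈ys gap) ⟩
      g y + sumOf g ys       ∎
    where
    open ≤-Reasoning
    swapFront : ∀ a b c → a + (b + c) ≡ b + (a + c)
    swapFront = solve-∀

  sumOf-member : ∀ (f : A → ℕ) {x xs} → x ∈ xs → f x ≤ sumOf f xs
  sumOf-member f x∈xs =
    ≤-trans (m≤m+n _ _) (sumOf-slack {f = λ _ → 0} (λ _ → z≤n) x∈xs (≤-reflexive (+-identityʳ _)))

  sumOf-swap : ∀ (F : A → A → ℕ) xs ys →
               sumOf (λ x → sumOf (F x) ys) xs ≡ sumOf (λ y → sumOf (λ x → F x y) xs) ys
  sumOf-swap F []       ys = sym (trans (sumOf-const 0 ys) (*-zeroˡ (length ys)))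
  sumOf-swap F (x ∷ xs) ys rewrite sumOf-swap F xs ys =
    sym (sumOf-+ (F x) (λ y → sumOf (λ x′ → F x′ y) xs) ys)

  sumIf : (A → Bool) → (A → ℕ) → List A → ℕ
  sumIf p w = sumOf (λ x → if p x then w x else 0)

  sumIf-mono : ∀ p {w w′ : A → ℕ} → (∀ x → p x ≡ true → w x ≤ w′ x) → ∀ xs →
               sumIf p w xs ≤ sumIf p w′ xs
  sumIf-mono p {w} {w′} w≤w′ = sumOf-mono pointwise
    where
    pointwise : ∀ x → (if p x then w x else 0) ≤ (if p x then w′ x else 0)
    pointwise x with p x in px
    ... | true  = w≤w′ x px
    ... | false = z≤n

  sumIf-cong : ∀ p {w w′ : A → ℕ} → (∀ x → p x ≡ true → w x ≡ w′ x) → ∀ xs →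
               sumIf p w xs ≡ sumIf p w′ xs
  sumIf-cong p w≡w′ xs = ≤-antisym
    (sumIf-mono p (λ x px → ≤-reflexive (w≡w′ x px)) xs)
    (sumIf-mono p (λ x px → ≤-reflexive (sym (w≡w′ x px))) xs)

  sumIf-strict : ∀ p {w w′ : A → ℕ} → (∀ x → p x ≡ true → w x ≤ w′ x) →
                 ∀ {x xs} → x ∈ xs → p x ≡ true → w x < w′ x → sumIf p w xs < sumIf p w′ xs
  sumIf-strict p {w} {w′} w≤w′ {x} x∈xs px wx<w′x = sumOf-slack pointwise x∈xs gap
    where
    pointwise : ∀ y → (if p y then w y else 0) ≤ (if p y then w′ y else 0)
    pointwise y with p y in py
    ... | true  = w≤w′ y py
    ... | false = z≤n
    gap : 1 + (if p x then w x else 0) ≤ (if p x then w′ x else 0)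
    gap rewrite px = wx<w′x

  sumIf-+ : ∀ p (w w′ : A → ℕ) xs → sumIf p (λ x → w x + w′ x) xs ≡ sumIf p w xs + sumIf p w′ xs
  sumIf-+ p w w′ xs = trans (sumOf-cong pointwise xs) (sumOf-+ _ _ xs)
    where
    pointwise : ∀ x → (if p x then w x + w′ x else 0) ≡ (if p x then w x else 0) + (if p x then w′ x else 0)
    pointwise x with p x
    ... | true  = refl
    ... | false = refl

  sumIf-const : ∀ p c (xs : List A) → sumIf p (λ _ → c) xs ≡ c * sumIf p (λ _ → 1) xs
  sumIf-const p c xs = trans (sumOf-cong pointwise xs) (sumOf-* c _ xs)
    where
    pointwise : ∀ x → (if p x then c else 0) ≡ c * (if p x then 1 else 0)
    pointwise x with p x
    ... | true  = sym (*-identityʳ c)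
    ... | false = sym (*-zeroʳ c)

  sumIf-member : ∀ p (w : A → ℕ) {x xs} → x ∈ xs → p x ≡ true → w x ≤ sumIf p w xs
  sumIf-member p w {x} {xs} x∈xs px =
    subst (_≤ sumIf p w xs) chosen (sumOf-member (λ y → if p y then w y else 0) x∈xs)
    where
    chosen : (if p x then w x else 0) ≡ w x
    chosen rewrite px = refl

  sumIf-single : ∀ p (w : A → ℕ) {x xs} → x ∈ xs → p x ≡ true → sumIf p (λ _ → 1) xs ≡ 1 →
                 sumIf p w xs ≡ w x
  sumIf-single p w {xs = y ∷ ys} (here refl) px one rewrite px =
    trans (cong (w y +_) (sumIf-none ys (cong pred one))) (+-identityʳ (w y))
    where
    sumIf-none : ∀ zs → sumIf p (λ _ → 1) zs ≡ 0 → sumIf p w zs ≡ 0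
    sumIf-none []       _    = refl
    sumIf-none (z ∷ zs) none with p z
    ... | false = sumIf-none zs none
  sumIf-single p w {x} {y ∷ ys} (there x∈ys) px one with p y
  ... | false = sumIf-single p w x∈ys px one
  ... | true  = ⊥-elim (1+n≰n (begin-strict
      1                        ≤⟨ sumIf-member p (λ _ → 1) x∈ys px ⟩
      sumIf p (λ _ → 1) ys     <⟨ n<1+n _ ⟩
      1 + sumIf p (λ _ → 1) ys ≡⟨ one ⟩
      1                        ∎))
    where open ≤-Reasoning

open ListSums

n≤n*n : ∀ s → s ≤ s * s
n≤n*n zero    = z≤n
n≤n*n (suc s) = m≤m*n (suc s) (suc s)

square-split : ∀ d k → d * d + d * (k ∸ d) ≡ k * d + d * (d ∸ k)
square-split d k with ≤-total d k
... | inj₁ d≤k with m≤n⇒∃[o]m+o≡n d≤k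
...   | e , refl rewrite m+n∸m≡n d e | m≤n⇒m∸n≡0 (m≤m+n d e) = identity d e
  where
  identity : ∀ d e → d * d + d * e ≡ (d + e) * d + d * 0
  identity = solve-∀
square-split d k | inj₂ k≤d with m≤n⇒∃[o]m+o≡n k≤d
...   | e , refl rewrite m+n∸m≡n k e | m≤n⇒m∸n≡0 (m≤m+n k e) = identity k e
  where
  identity : ∀ k e → (k + e) * (k + e) + (k + e) * 0 ≡ k * (k + e) + (k + e) * e
  identity = solve-∀

amgm-ordered : ∀ a r → 4 * (a * (a + r)) ≤ (a + (a + r)) * (a + (a + r))
amgm-ordered a r = ≤-trans (m≤m+n _ (r * r)) (≤-reflexive (identity a r))
  where
  identity : ∀ a r → 4 * (a * (a + r)) + r * r ≡ (a + (a + r)) * (a + (a + r))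
  identity = solve-∀

amgm : ∀ a b → 4 * (a * b) ≤ (a + b) * (a + b)
amgm a b with ≤-total a b
... | inj₁ a≤b with m≤n⇒∃[o]m+o≡n a≤b
...   | r , refl = amgm-ordered a r
amgm a b | inj₂ b≤a with m≤n⇒∃[o]m+o≡n b≤a
...   | r , refl = subst₂ _≤_ (cong (4 *_) (*-comm b (b + r))) (cong (λ s → s * s) (+-comm b (b + r)))
                     (amgm-ordered b r)

deficit-bound : ∀ d k → 4 * (d * (k ∸ d)) ≤ k * k
deficit-bound d k with ≤-total d k
... | inj₁ d≤k with m≤n⇒∃[o]m+o≡n d≤k
...   | e , refl rewrite m+n∸m≡n d e = amgm d e
deficit-bound d k | inj₂ k≤d rewrite m≤n⇒m∸n≡0 k≤d | *-zeroʳ d = z≤n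

-- (k − 2)² + 1 ≥ 0, i.e. 4k ≤ k² + 5; so k² − 3k + 5 ≥ k.
4k≤k²+5 : ∀ k → 4 * k ≤ k * k + 5
4k≤k²+5 0             = z≤n
4k≤k²+5 1             = s≤s (s≤s (s≤s (s≤s z≤n)))
4k≤k²+5 (suc (suc m)) = ≤-trans (m≤m+n _ (m * m + 1)) (≤-reflexive (identity m))
  where
  identity : ∀ m → 4 * (2 + m) + (m * m + 1) ≡ (2 + m) * (2 + m) + 5
  identity = solve-∀

-- The threshold k² − 3k + 5 written without truncated subtraction: it is k + e
-- with 4k + e = k² + 5.
threshold-split : ∀ k → ∃ λ e → 4 * k + e ≡ k * k + 5 × k * k + 5 ∸ 3 * k ≡ k + e
threshold-split k with m≤n⇒∃[o]m+o≡n (4k≤k²+5 k)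
... | e , split = e , split , (begin
    k * k + 5 ∸ 3 * k       ≡⟨ cong (_∸ 3 * k) split ⟨
    4 * k + e ∸ 3 * k       ≡⟨ cong (_∸ 3 * k) (regroup k e) ⟩
    3 * k + (k + e) ∸ 3 * k ≡⟨ m+n∸m≡n (3 * k) (k + e) ⟩
    k + e                   ∎)
  where
  open ≡-Reasoning
  regroup : ∀ k e → 4 * k + e ≡ 3 * k + (k + e)
  regroup = solve-∀

∸-threshold : ∀ {m n d} → m ∸ n ≤ d → m ≤ d + n
∸-threshold {m} {n} {d} h = ≤-trans (m≤n+m∸n m n) (≤-trans (+-monoʳ-≤ n h) (≤-reflexive (+-comm n d)))

degree-gap : ∀ {k d t} → k * k + 5 ≤ d + 3 * k → t < k → 2 * t + (d ∸ 2) ≤ k * t → ⊥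
degree-gap {k} {d} {t} threshold t<k low with m≤n⇒∃[o]m+o≡n t<k
... | s , refl = 1+n≰n (≤-trans (≤-reflexive (+-comm 1 _)) (≤-trans leftover s≤s²+ts))
  where
  K = suc t + s
  s≤s²+ts : s ≤ s * s + t * s
  s≤s²+ts = ≤-trans (n≤n*n s) (m≤m+n (s * s) (t * s))
  low′ : 2 * t + d ≤ K * t + 2
  low′ = begin
    2 * t + d             ≤⟨ +-monoʳ-≤ (2 * t) (m≤n+m∸n d 2) ⟩
    2 * t + (2 + (d ∸ 2)) ≡⟨ shift (2 * t) (d ∸ 2) ⟩
    2 * t + (d ∸ 2) + 2   ≤⟨ +-monoˡ-≤ 2 low ⟩
    K * t + 2             ∎
    where
    open ≤-Reasoning
    shift : ∀ a b → a + (2 + b) ≡ a + b + 2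
    shift = solve-∀
  identity : ∀ t s d → (suc t + s) * (suc t + s) + 5 + (2 * t + d) + s
                       ≡ d + 3 * (suc t + s) + ((suc t + s) * t + 2) + (s * s + t * s + 1)
  identity = solve-∀
  -- Writing k = t + 1 + s, the two hypotheses leave s² + ts + 1 ≤ s.
  leftover : s * s + t * s + 1 ≤ s
  leftover = +-cancelˡ-≤ (d + 3 * K + (K * t + 2)) _ _ (begin
    d + 3 * K + (K * t + 2) + (s * s + t * s + 1) ≡⟨ identity t s d ⟨
    K * K + 5 + (2 * t + d) + s                     ≤⟨ +-monoˡ-≤ s (+-mono-≤ threshold low′) ⟩
    d + 3 * K + (K * t + 2) + s                     ∎)
    where open ≤-Reasoning

countingBound : ℕ → ℕ → ℕ
countingBound k d = k * k + (k * k * d + 4 * (d * (d ∸ k)))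

countingBound-mono : ∀ k {d d′} → d ≤ d′ → countingBound k d ≤ countingBound k d′
countingBound-mono k d≤d′ =
  +-monoʳ-≤ (k * k) (+-mono-≤ (*-monoʳ-≤ (k * k) d≤d′) (*-monoʳ-≤ 4 (*-mono-≤ d≤d′ (∸-monoˡ-≤ k d≤d′))))

-- nbrSum G i w = Σ_{j ~ i} w j.  Definitionally, d_i = nbrSum G i (λ _ → 1) and
-- d_i m_i = twoDegSum G i = nbrSum G i (deg G).
nbrSum : ∀ {n} → Graph n → Fin n → (Fin n → ℕ) → ℕ
nbrSum {n} G i w = sumIf (adj G i) w (allFin n)

module GraphSums {n : ℕ} (G : Graph n) where

  nbrSum-const : ∀ i c → nbrSum G i (λ _ → c) ≡ c * deg G i
  nbrSum-const i c = sumIf-const (adj G i) c (allFin n)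

  handshake : ∀ (w : Fin n → ℕ) → Σv (λ v → nbrSum G v w) ≡ Σv (λ u → deg G u * w u)
  handshake w = begin
      sumOf (λ v → sumOf (λ u → if adj G v u then w u else 0) vertices) vertices
    ≡⟨ sumOf-swap (λ v u → if adj G v u then w u else 0) vertices vertices ⟩
      sumOf (λ u → sumOf (λ v → if adj G v u then w u else 0) vertices) vertices
    ≡⟨ sumOf-cong column vertices ⟩
      sumOf (λ u → deg G u * w u) vertices
    ∎
    where
    open ≡-Reasoning
    vertices = allFin n
    column : ∀ u → sumOf (λ v → if adj G v u then w u else 0) vertices ≡ deg G u * w u
    column u = begin
        sumOf (λ v → if adj G v u then w u else 0) vertices
      ≡⟨ sumOf-cong (λ v → cong (λ b → if b then w u else 0) (Graph.sym G v u)) vertices ⟩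
        nbrSum G u (λ _ → w u)
      ≡⟨ nbrSum-const u (w u) ⟩
        w u * deg G u
      ≡⟨ *-comm (w u) (deg G u) ⟩
        deg G u * w u
      ∎

module HarmonicGraph {n : ℕ} (k : ℕ) (G : Graph n) (harmonic : Harmonic k G) where
  open GraphSums G

  -- The only neighbour j of a vertex l of degree 1 has d_j = d_l m_l = k.
  leafNeighbour : ∀ l j → deg G l ≡ 1 → adj G l j ≡ true → deg G j ≡ k
  leafNeighbour l j leaf l~j = begin
    deg G j       ≡⟨ sumIf-single (adj G l) (deg G) (∈-allFin j) l~j leaf ⟨
    twoDegSum G l ≡⟨ harmonic l ⟩
    k * deg G l   ≡⟨ cong (k *_) leaf ⟩
    k * 1         ≡⟨ *-identityʳ k ⟩
    k             ∎
    where open ≡-Reasoning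

  -- If a neighbour j of i has d_j < k then no neighbour of j is a leaf (it would force
  -- d_j = k), so k d_j = Σ_{m ~ j} d_m ≥ 2 d_j + (d_i ∸ 2).
  smallNeighbourBound : NoIsolated G → ∀ i j → adj G i j ≡ true → deg G j < k →
                        2 * deg G j + (deg G i ∸ 2) ≤ k * deg G j
  smallNeighbourBound noIsolated i j i~j small = begin
      2 * deg G j + (deg G i ∸ 2)
    ≤⟨ +-monoʳ-≤ (2 * deg G j) (sumIf-member (adj G j) (λ m → deg G m ∸ 2) (∈-allFin i) j~i) ⟩
      2 * deg G j + nbrSum G j (λ m → deg G m ∸ 2)
    ≡⟨ cong (_+ nbrSum G j (λ m → deg G m ∸ 2)) (nbrSum-const j 2) ⟨
      nbrSum G j (λ _ → 2) + nbrSum G j (λ m → deg G m ∸ 2)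
    ≡⟨ sumIf-+ (adj G j) (λ _ → 2) (λ m → deg G m ∸ 2) (allFin n) ⟨
      nbrSum G j (λ m → 2 + (deg G m ∸ 2))
    ≡⟨ sumIf-cong (adj G j) (λ m j~m → m+[n∸m]≡n (atLeastTwo m j~m)) (allFin n) ⟩
      twoDegSum G j
    ≡⟨ harmonic j ⟩
      k * deg G j
    ∎
    where
    open ≤-Reasoning
    j~i : adj G j i ≡ true
    j~i = trans (Graph.sym G j i) i~j
    atLeastTwo : ∀ m → adj G j m ≡ true → 2 ≤ deg G m
    atLeastTwo m j~m = ≤∧≢⇒< (noIsolated m)
      (λ leaf → <-irrefl (leafNeighbour m j (sym leaf) (trans (Graph.sym G m j) j~m)) small)

  -- As Σ_{j ~ i} d_j = k d_i = Σ_{j ~ i} k, if no neighbour of i has degree below k then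
  -- every neighbour of i has degree exactly k.
  neighboursExact : ∀ i → (∀ j → adj G i j ≡ true → k ≤ deg G j) →
                    ∀ j → adj G i j ≡ true → deg G j ≡ k
  neighboursExact i atLeast j i~j with m≤n⇒m<n∨m≡n (atLeast j i~j)
  ... | inj₂ k≡dⱼ = sym k≡dⱼ
  ... | inj₁ k<dⱼ = ⊥-elim (<-irrefl balanced (sumIf-strict (adj G i) atLeast (∈-allFin j) i~j k<dⱼ))
    where
    balanced : nbrSum G i (λ _ → k) ≡ twoDegSum G i
    balanced = trans (nbrSum-const i k) (sym (harmonic i))

  highDegreeNeighbours : NoIsolated G → ∀ i → k * k + 5 ≤ deg G i + 3 * k →
                         ∀ j → adj G i j ≡ true → deg G j ≡ k
  highDegreeNeighbours noIsolated i threshold = neighboursExact i λ j i~j →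
    ≮⇒≥ (λ small → degree-gap {k} {deg G i} {deg G j} threshold small (smallNeighbourBound noIsolated i j i~j small))

  deficit excess : Fin n → ℕ
  deficit v = deg G v * (k ∸ deg G v)
  excess  v = deg G v * (deg G v ∸ k)

  -- Σ_v d_v² = Σ_v Σ_{u ~ v} d_u = Σ_v k d_v.
  degreeSquareSum : Σv (λ v → deg G v * deg G v) ≡ Σv (λ v → k * deg G v)
  degreeSquareSum = trans (sym (handshake (deg G))) (sumOf-cong harmonic (allFin n))

  deficitBalance : Σv deficit ≡ Σv excess
  deficitBalance = +-cancelˡ-≡ (Σv square) _ _ (begin
      Σv square + Σv deficit              ≡⟨ sumOf-+ square deficit vertices ⟨
      Σv (λ v → square v + deficit v)     ≡⟨ sumOf-cong (λ v → square-split (deg G v) k) vertices ⟩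
      Σv (λ v → k * deg G v + excess v)   ≡⟨ sumOf-+ (λ v → k * deg G v) excess vertices ⟩
      Σv (λ v → k * deg G v) + Σv excess  ≡⟨ cong (_+ Σv excess) degreeSquareSum ⟨
      Σv square + Σv excess               ∎)
    where
    open ≡-Reasoning
    vertices = allFin n
    square : Fin n → ℕ
    square v = deg G v * deg G v

  -- Vertex v contributes k² if v ~ i and 4·deficit v ≤ k² otherwise, and i contributes 0;
  -- the contributions total k²d + 4 Σ deficit ≥ k²d + 4·excess i, whence the bound.
  orderBound : ∀ i → k ≤ deg G i → (∀ j → adj G i j ≡ true → deg G j ≡ k) →
               countingBound k (deg G i) ≤ k * k * n
  orderBound i k≤dᵢ regular = begin
      k * k + (k * k * deg G i + 4 * excess i)
    ≤⟨ +-monoʳ-≤ (k * k) (+-monoʳ-≤ (k * k * deg G i) (*-monoʳ-≤ 4 excessᵢ≤deficits)) ⟩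
      k * k + (k * k * deg G i + 4 * Σv deficit)
    ≡⟨ cong (k * k +_) totalContribution ⟨
      k * k + Σv contribution
    ≤⟨ sumOf-slack {g = λ _ → k * k} contribution≤k² (∈-allFin i) (≤-reflexive (trans (cong (k * k +_) contributionᵢ) (+-identityʳ (k * k)))) ⟩
      Σv {n} (λ _ → k * k)
    ≡⟨ sumOf-const (k * k) (allFin n) ⟩
      k * k * length (allFin n)
    ≡⟨ cong (k * k *_) (length-tabulate {n = n} (λ v → v)) ⟩
      k * k * n
    ∎
    where
    open ≤-Reasoning
    contribution : Fin n → ℕ
    contribution v = (if adj G i v then k * k else 0) + 4 * deficit v
    contribution≤k² : ∀ v → contribution v ≤ k * k
    contribution≤k² v with adj G i v in i~v
    ... | false = deficit-bound (deg G v) k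
    ... | true rewrite regular v i~v | n∸n≡0 k | *-zeroʳ k = ≤-reflexive (+-identityʳ (k * k))
    contributionᵢ : contribution i ≡ 0
    contributionᵢ rewrite Graph.irrefl G i | m≤n⇒m∸n≡0 k≤dᵢ | *-zeroʳ (deg G i) = refl
    totalContribution : Σv contribution ≡ k * k * deg G i + 4 * Σv deficit
    totalContribution = trans (sumOf-+ _ (λ v → 4 * deficit v) (allFin n))
      (cong₂ _+_ (nbrSum-const i (k * k)) (sumOf-* 4 deficit (allFin n)))
    excessᵢ≤deficits : excess i ≤ Σv deficit
    excessᵢ≤deficits = ≤-trans (sumOf-member excess (∈-allFin i)) (≤-reflexive (sym deficitBalance))

numer-countingBound : ∀ k e → 4 * k + e ≡ k * k + 5 → numer k ≡ ℤ.+ countingBound k (k + e)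
numer-countingBound k e split rewrite m+n∸m≡n k e = begin
    numer k
  ≡⟨ polynomial z ⟩
    z ℤ.* z ℤ.+ (z ℤ.* z ℤ.* (z ℤ.+ E) ℤ.+ ℤ.+ 4 ℤ.* ((z ℤ.+ E) ℤ.* E))
  ≡⟨ cong (λ w → z ℤ.* z ℤ.+ (z ℤ.* z ℤ.* (z ℤ.+ w) ℤ.+ ℤ.+ 4 ℤ.* ((z ℤ.+ w) ℤ.* w))) e≡E ⟨
    z ℤ.* z ℤ.+ (z ℤ.* z ℤ.* (z ℤ.+ w) ℤ.+ ℤ.+ 4 ℤ.* ((z ℤ.+ w) ℤ.* w))
  ≡⟨ cast ⟨
    ℤ.+ (k * k + (k * k * (k + e) + 4 * ((k + e) * e)))
  ∎
  where
  open ≡-Reasoning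
  open ℤP using (pos-+; pos-*)
  z w E : ℤ
  z = ℤ.+ k
  w = ℤ.+ e
  E = z ℤ.* z ℤ.+ ℤ.+ 5 ℤ.- ℤ.+ 4 ℤ.* z
  e≡E : w ≡ E
  e≡E = begin
      w                                 ≡⟨ isolate z w ⟩
      ℤ.+ 4 ℤ.* z ℤ.+ w ℤ.- ℤ.+ 4 ℤ.* z ≡⟨ cong (ℤ._- ℤ.+ 4 ℤ.* z) castSplit ⟩
      E                                 ∎
    where
    isolate : ∀ z w → w ≡ ℤ.+ 4 ℤ.* z ℤ.+ w ℤ.- ℤ.+ 4 ℤ.* z
    isolate = ℤSolver.solve-∀
    castSplit : ℤ.+ 4 ℤ.* z ℤ.+ w ≡ z ℤ.* z ℤ.+ ℤ.+ 5
    castSplit = begin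
      ℤ.+ 4 ℤ.* z ℤ.+ w  ≡⟨ cong (ℤ._+ w) (pos-* 4 k) ⟨
      ℤ.+ (4 * k + e)    ≡⟨ cong ℤ.+_ split ⟩
      ℤ.+ (k * k + 5)    ≡⟨ cong (ℤ._+ ℤ.+ 5) (pos-* k k) ⟩
      z ℤ.* z ℤ.+ ℤ.+ 5  ∎
  polynomial : ∀ z → let E = z ℤ.* z ℤ.+ ℤ.+ 5 ℤ.- ℤ.+ 4 ℤ.* z in
    ℤ.+ 5 ℤ.* z ℤ.* z ℤ.* z ℤ.* z ℤ.- ℤ.+ 31 ℤ.* z ℤ.* z ℤ.* z
      ℤ.+ ℤ.+ 94 ℤ.* z ℤ.* z ℤ.- ℤ.+ 140 ℤ.* z ℤ.+ ℤ.+ 100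
    ≡ z ℤ.* z ℤ.+ (z ℤ.* z ℤ.* (z ℤ.+ E) ℤ.+ ℤ.+ 4 ℤ.* ((z ℤ.+ E) ℤ.* E))
  polynomial = ℤSolver.solve-∀
  cast : ℤ.+ (k * k + (k * k * (k + e) + 4 * ((k + e) * e)))
         ≡ z ℤ.* z ℤ.+ (z ℤ.* z ℤ.* (z ℤ.+ w) ℤ.+ ℤ.+ 4 ℤ.* ((z ℤ.+ w) ℤ.* w))
  cast = trans (pos-+ (k * k) _) (cong₂ ℤ._+_ (pos-* k k) (trans (pos-+ (k * k * (k + e)) _)
           (cong₂ ℤ._+_ (trans (pos-* (k * k) (k + e)) (cong₂ ℤ._*_ (pos-* k k) (pos-+ k e)))
                        (trans (pos-* 4 ((k + e) * e)) (cong (ℤ.+ 4 ℤ.*_)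
                          (trans (pos-* (k + e) e) (cong (ℤ._* w) (pos-+ k e))))))))

ceilDiv-least : ∀ a d q → a ℤ.≤ ℤ.+ q ℤ.* ℤ.+ suc d → ceilDiv a d ℤ.≤ ℤ.+ q
ceilDiv-least a d q a≤qD =
  subst (ceilDiv a d ℤ.≤_) (ℤP.neg-involutive (ℤ.+ q)) (ℤP.neg-mono-≤ -q≤Q)
  where
  Q : ℤ
  Q = (- a) ℤDiv./ℕ suc d
  below : (- ℤ.+ q) ℤ.* ℤ.+ suc d ℤ.< ℤ.suc Q ℤ.* ℤ.+ suc d
  below = ℤP.≤-<-trans
    (subst (ℤ._≤ - a) (ℤP.neg-distribˡ-* (ℤ.+ q) (ℤ.+ suc d)) (ℤP.neg-mono-≤ a≤qD))
    (ℤDiv.n<s[n/ℕd]*d (- a) (suc d))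
  -q≤Q : - ℤ.+ q ℤ.≤ Q
  -q≤Q = subst (- ℤ.+ q ℤ.≤_) (ℤP.pred-suc Q)
    (ℤP.i<j⇒i≤pred[j] {j = ℤ.suc Q} (ℤP.*-cancelʳ-<-nonNeg (ℤ.+ suc d) below))

f-least : ∀ k′ q → numer (suc k′) ℤ.≤ ℤ.+ (suc k′ * suc k′ * q) → f (suc k′) ℤ.≤ ℤ.+ q
f-least k′ q bound = ceilDiv-least (numer (suc k′)) (k′ * suc k′ + k′) q
  (subst (numer (suc k′) ℤ.≤_) (trans (cong ℤ.+_ (reorder k′ q)) (ℤP.pos-* q _)) bound)
  where
  reorder : ∀ k′ q → suc k′ * suc k′ * q ≡ q * suc (k′ * suc k′ + k′)
  reorder = solve-∀

corollary4p9 : (k n : ℕ) → 1 ≤ k → (G : Graph n) → NoIsolated G →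
    PseudoRegular k G → (i : Fin n) → k * k + 5 ∸ 3 * k ≤ deg G i →
    ((j : Fin n) → adj G i j ≡ true → deg G j ≡ k) × (f k ℤ.≤ ℤ.+ n)
corollary4p9 zero     n () G
corollary4p9 (suc k′) n _  G noIsolated (harmonic , _) i highDegree
  with threshold-split (suc k′)
... | e , split , d₀≡k+e = neighboursRegular , orderLowerBound
  where
  k = suc k′
  open HarmonicGraph k G harmonic
  neighboursRegular : ∀ j → adj G i j ≡ true → deg G j ≡ k
  neighboursRegular = highDegreeNeighbours noIsolated i (∸-threshold highDegree)
  k+e≤dᵢ : k + e ≤ deg G i
  k+e≤dᵢ = subst (_≤ deg G i) d₀≡k+e highDegree
  counting : countingBound k (k + e) ≤ k * k * n
  counting = ≤-trans (countingBound-mono k k+e≤dᵢ)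
    (orderBound i (≤-trans (m≤m+n k e) k+e≤dᵢ) neighboursRegular)
  orderLowerBound : f k ℤ.≤ ℤ.+ n
  orderLowerBound = f-least k′ n
    (subst (ℤ._≤ ℤ.+ (k * k * n)) (sym (numer-countingBound k e split)) (ℤ.+≤+ counting))
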